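{- If there exist integer weights $w_1,\ldots,w_n$ such that $|w(2^{[n]})| = a$ and $\beta(w) = b$, then there exists a uniquely decodable code pair $(A,B)$ with $A,B\subseteq\{0,1\}^n$, $|A| = a$ and $|B| = b$.
   Context: For $X \subseteq [n]$, $w(X) = \sum_{i\in X} w_i$, $w(2^{[n]}) = \{w(X): X\subseteq[n]\}$, and $\beta(w) = \max_{x\in\mathbb{Z}} |\{S \subseteq [n] : w(S) = x\}|$. A pair $(A,B)$ of sets $A,B \subseteq \{0,1\}^n$ is a uniquely decodable code pair if $|A+B| = |\{a+b : a\in A, b\in B\}| = |A|\cdot|B|$, where addition is performed in $\mathbb{Z}^n$ (not modulo 2). -}

module Defs where

open import Data.Bool using (Bool; true; false; if_then_else_)
open import Data.Nat as ℕ using (ℕ; _≤_)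
open import Data.Integer as ℤ using (ℤ)
open import Data.List using (List; []; _∷_; map; length; filter; deduplicate; concatMap; _++_)
open import Data.List.Relation.Unary.Unique.Propositional using (Unique)
open import Data.Vec using (Vec; []; _∷_; zipWith)
import Data.Vec.Properties as VecP
open import Data.Product using (Σ; _×_; _,_)
open import Relation.Binary.PropositionalEquality using (_≡_)

allSubsets : (n : ℕ) → List (Vec Bool n)
allSubsets ℕ.zero = [] ∷ []
allSubsets (ℕ.suc n) = map (false ∷_) (allSubsets n) ++ map (true ∷_) (allSubsets n)

wsum : ∀ {n} → Vec ℤ n → Vec Bool n → ℤ
wsum [] [] = ℤ.0ℤ
wsum (w ∷ ws) (b ∷ bs) = (if b then w else ℤ.0ℤ) ℤ.+ wsum ws bs

cardℤ : List ℤ → ℕ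
cardℤ xs = length (deduplicate ℤ._≟_ xs)

numSubsetSums : ∀ {n} → Vec ℤ n → ℕ
numSubsetSums {n} w = cardℤ (map (wsum w) (allSubsets n))

multiplicity : ∀ {n} → Vec ℤ n → ℤ → ℕ
multiplicity {n} w x = length (filter (λ S → wsum w S ℤ.≟ x) (allSubsets n))

IsBeta : ∀ {n} → Vec ℤ n → ℕ → Set
IsBeta w b = Σ ℤ (λ x → multiplicity w x ≡ b) × ((x : ℤ) → multiplicity w x ≤ b)

-- binary words {0,1}^n viewed in ℤ^n (entries in ℕ suffice since they are nonnegative)
toℕvec : ∀ {n} → Vec Bool n → Vec ℕ n
toℕvec [] = []
toℕvec (true ∷ bs) = 1 ∷ toℕvec bs
toℕvec (false ∷ bs) = 0 ∷ toℕvec bs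

addWords : ∀ {n} → Vec Bool n → Vec Bool n → Vec ℕ n
addWords a b = zipWith ℕ._+_ (toℕvec a) (toℕvec b)

sumList : ∀ {n} → List (Vec Bool n) → List (Vec Bool n) → List (Vec ℕ n)
sumList A B = concatMap (λ a → map (addWords a) B) A

sumSetCard : ∀ {n} → List (Vec Bool n) → List (Vec Bool n) → ℕ
sumSetCard A B = length (deduplicate (VecP.≡-dec ℕ._≟_) (sumList A B))

UDCodePair : ∀ {n} → List (Vec Bool n) → List (Vec Bool n) → Set
UDCodePair A B = Unique A × Unique B × (sumSetCard A B ≡ length A ℕ.* length B)

-- Take A to be one subset for each value of w(2^[n]) and B to be the full fibre
-- {S : w(S) = x} of a value x attained b times. The weighted sum is linear in the word
-- a + b ∈ ℤ^n, so w(a + b) = w(a) + x: the sum word determines w(a), hence a, and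
-- then b = (a + b) - a.
module Submission where

open import Defs
open import Data.Nat using (ℕ)
open import Data.Integer using (ℤ)
open import Data.Bool using (Bool)
open import Data.Vec using (Vec)
open import Data.List using (List; length)
open import Data.Product using (Σ; _×_)
open import Relation.Binary.PropositionalEquality using (_≡_)

import Data.Nat as ℕ
import Data.Nat.Properties as ℕP
import Data.Integer as ℤ
import Data.Integer.Properties as ℤP
open import Data.Integer.Solver using (module +-*-Solver)
open import Algebra.Properties.AbelianGroup ℤP.+-0-abelianGroup using (∙-cancelʳ)
open import Data.Bool using (true; false)
open import Data.Vec using ([]; _∷_; zipWith)
import Data.Vec.Properties as VecP
open import Data.List using ([]; _∷_; map; filter; deduplicate; concatMap; cartesianProductWith; _++_)
import Data.List.Properties as ListP
open import Data.List.Relation.Unary.All as All using (All)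
import Data.List.Relation.Unary.All.Properties as AllP
open import Data.List.Relation.Unary.AllPairs as AllPairs using (AllPairs; []; _∷_)
open import Data.List.Relation.Unary.Unique.Propositional using (Unique)
import Data.List.Relation.Unary.Unique.Propositional.Properties as UniqueP
open import Data.List.Relation.Unary.Unique.DecSetoid.Properties using (deduplicate-!)
open import Data.List.Membership.Propositional using (_∈_)
open import Data.List.Membership.Propositional.Properties using (∈-map⁻; ∈-cartesianProductWith⁻)
open import Data.List.Relation.Unary.Any using (here; there)
open import Data.Product using (_,_; proj₁; proj₂)
open import Data.Empty using (⊥-elim)
open import Relation.Nullary using (¬_; Dec; yes; no; ¬?)
open import Relation.Unary using (Decidable)
import Relation.Binary.Construct.On as On
open import Relation.Binary.PropositionalEquality using (refl; sym; trans; cong; cong₂; subst; _≢_; module ≡-Reasoning)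
open import Function using (_∘_)

module _ {A B : Set} where

  map-filter : {P : B → Set} (P? : Decidable P) (f : A → B) (xs : List A) →
               map f (filter (P? ∘ f) xs) ≡ filter P? (map f xs)
  map-filter P? f [] = refl
  map-filter P? f (x ∷ xs) with P? (f x)
  ... | yes _ = cong (f x ∷_) (map-filter P? f xs)
  ... | no  _ = map-filter P? f xs

  map-deduplicate-on : (_≟_ : (u v : B) → Dec (u ≡ v)) (f : A → B) (xs : List A) →
                       map f (deduplicate (λ x y → f x ≟ f y) xs) ≡ deduplicate _≟_ (map f xs)
  map-deduplicate-on _≟_ f [] = refl
  map-deduplicate-on _≟_ f (x ∷ xs) = cong (f x ∷_) (begin
    map f (filter (¬? ∘ (f x ≟_) ∘ f) rest)             ≡⟨ map-filter (¬? ∘ (f x ≟_)) f rest ⟩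
    filter (¬? ∘ (f x ≟_)) (map f rest)                 ≡⟨ cong (filter (¬? ∘ (f x ≟_))) (map-deduplicate-on _≟_ f xs) ⟩
    filter (¬? ∘ (f x ≟_)) (deduplicate _≟_ (map f xs)) ∎)
    where
    open ≡-Reasoning
    rest : List A
    rest = deduplicate (λ x y → f x ≟ f y) xs

deduplicate-unique : {A : Set} (_≟_ : (x y : A) → Dec (x ≡ y)) {xs : List A} →
                     Unique xs → deduplicate _≟_ xs ≡ xs
deduplicate-unique _≟_ {[]} [] = refl
deduplicate-unique _≟_ {x ∷ xs} (x∉xs ∷ u)
  rewrite deduplicate-unique _≟_ u = cong (x ∷_) (ListP.filter-all (¬? ∘ (x ≟_)) x∉xs)

map⁺-injectiveOn : {A B : Set} (f : A → B) {xs : List A} →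
                   (∀ {x y} → x ∈ xs → y ∈ xs → f x ≡ f y → x ≡ y) →
                   Unique xs → Unique (map f xs)
map⁺-injectiveOn f {[]} inj [] = []
map⁺-injectiveOn f {x ∷ xs} inj (x∉xs ∷ u) =
  AllP.map⁺ (All.tabulate (λ y∈xs fx≡fy → All.lookup x∉xs y∈xs (inj (here refl) (there y∈xs) fx≡fy)))
  ∷ map⁺-injectiveOn f (λ x∈ y∈ → inj (there x∈) (there y∈)) u

distinctImages⇒injectiveOn : {A B : Set} (f : A → B) {xs : List A} →
  AllPairs (λ x y → f x ≢ f y) xs → ∀ {x y} → x ∈ xs → y ∈ xs → f x ≡ f y → x ≡ y
distinctImages⇒injectiveOn f (_ ∷ _) (here refl) (here refl) _ = refl
distinctImages⇒injectiveOn f (x≢ ∷ _) (here refl) (there y∈) fx≡fy = ⊥-elim (All.lookup x≢ y∈ fx≡fy)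
distinctImages⇒injectiveOn f (y≢ ∷ _) (there x∈) (here refl) fx≡fy = ⊥-elim (All.lookup y≢ x∈ (sym fx≡fy))
distinctImages⇒injectiveOn f (_ ∷ d) (there x∈) (there y∈) fx≡fy = distinctImages⇒injectiveOn f d x∈ y∈ fx≡fy

module _ {A B C : Set} (f : A → B → C) where

  concatMap≡cartesianProductWith : ∀ xs ys → concatMap (λ x → map (f x) ys) xs ≡ cartesianProductWith f xs ys
  concatMap≡cartesianProductWith [] ys = refl
  concatMap≡cartesianProductWith (x ∷ xs) ys = cong (map (f x) ys ++_) (concatMap≡cartesianProductWith xs ys)

  length-cartesianProductWith : ∀ xs ys → length (cartesianProductWith f xs ys) ≡ length xs ℕ.* length ys
  length-cartesianProductWith [] ys = refl
  length-cartesianProductWith (x ∷ xs) ys = trans (ListP.length-++ (map (f x) ys))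
    (cong₂ ℕ._+_ (ListP.length-map (f x) ys) (length-cartesianProductWith xs ys))

  cartesianProductWith⁺-injectiveOn : ∀ {xs ys} →
    (∀ {x x′ y y′} → x ∈ xs → x′ ∈ xs → y ∈ ys → y′ ∈ ys → f x y ≡ f x′ y′ → x ≡ x′ × y ≡ y′) →
    Unique xs → Unique ys → Unique (cartesianProductWith f xs ys)
  cartesianProductWith⁺-injectiveOn {[]} inj [] uys = []
  cartesianProductWith⁺-injectiveOn {x ∷ xs} {ys} inj (x∉xs ∷ uxs) uys = UniqueP.++⁺
    (map⁺-injectiveOn (f x) (λ y∈ y′∈ → proj₂ ∘ inj (here refl) (here refl) y∈ y′∈) uys)
    (cartesianProductWith⁺-injectiveOn (λ x∈ x′∈ → inj (there x∈) (there x′∈)) uxs uys)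
    disjoint
    where
    disjoint : ∀ {v} → ¬ (v ∈ map (f x) ys × v ∈ cartesianProductWith f xs ys)
    disjoint (v∈row , v∈rest) with ∈-map⁻ (f x) v∈row | ∈-cartesianProductWith⁻ f xs ys v∈rest
    ... | y , y∈ , refl | x′ , y′ , x′∈ , y′∈ , eq =
      All.lookup x∉xs x′∈ (proj₁ (inj (here refl) (there x′∈) y∈ y′∈ eq))

allSubsets-unique : ∀ n → Unique (allSubsets n)
allSubsets-unique ℕ.zero = All.[] ∷ []
allSubsets-unique (ℕ.suc n) = UniqueP.++⁺
  (UniqueP.map⁺ VecP.∷-injectiveʳ (allSubsets-unique n))
  (UniqueP.map⁺ VecP.∷-injectiveʳ (allSubsets-unique n))
  disjoint
  where
  disjoint : ∀ {v} → ¬ (v ∈ map (false ∷_) (allSubsets n) × v ∈ map (true ∷_) (allSubsets n))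
  disjoint (v∈₀ , v∈₁) with ∈-map⁻ (false ∷_) v∈₀ | ∈-map⁻ (true ∷_) v∈₁
  ... | _ , _ , refl | _ , _ , ()

infixl 7 _·_

_·_ : ∀ {n} → Vec ℤ n → Vec ℕ n → ℤ
[] · [] = ℤ.0ℤ
(w ∷ ws) · (k ∷ ks) = w ℤ.* ℤ.+ k ℤ.+ ws · ks

·-distribˡ-zipWith-+ : ∀ {n} (w : Vec ℤ n) u v → w · zipWith ℕ._+_ u v ≡ w · u ℤ.+ w · v
·-distribˡ-zipWith-+ [] [] [] = refl
·-distribˡ-zipWith-+ (w ∷ ws) (k ∷ ks) (l ∷ ls)
  rewrite ℤP.pos-+ k l | ·-distribˡ-zipWith-+ ws ks ls =
  solve 5 (λ w k l x y → w :* (k :+ l) :+ (x :+ y) := (w :* k :+ x) :+ (w :* l :+ y))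
        refl w (ℤ.+ k) (ℤ.+ l) (ws · ks) (ws · ls)
  where open +-*-Solver

wsum≡·toℕvec : ∀ {n} (w : Vec ℤ n) S → wsum w S ≡ w · toℕvec S
wsum≡·toℕvec [] [] = refl
wsum≡·toℕvec (w ∷ ws) (true ∷ S) = cong₂ ℤ._+_ (sym (ℤP.*-identityʳ w)) (wsum≡·toℕvec ws S)
wsum≡·toℕvec (w ∷ ws) (false ∷ S) = cong₂ ℤ._+_ (sym (ℤP.*-zeroʳ w)) (wsum≡·toℕvec ws S)

·-addWords : ∀ {n} (w : Vec ℤ n) S T → w · addWords S T ≡ wsum w S ℤ.+ wsum w T
·-addWords w S T = trans (·-distribˡ-zipWith-+ w (toℕvec S) (toℕvec T))
  (sym (cong₂ ℤ._+_ (wsum≡·toℕvec w S) (wsum≡·toℕvec w T)))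

toℕvec-injective : ∀ {n} {S T : Vec Bool n} → toℕvec S ≡ toℕvec T → S ≡ T
toℕvec-injective {S = []} {[]} _ = refl
toℕvec-injective {S = true ∷ S} {true ∷ T} eq = cong (true ∷_) (toℕvec-injective (VecP.∷-injectiveʳ eq))
toℕvec-injective {S = false ∷ S} {false ∷ T} eq = cong (false ∷_) (toℕvec-injective (VecP.∷-injectiveʳ eq))
toℕvec-injective {S = true ∷ S} {false ∷ T} ()
toℕvec-injective {S = false ∷ S} {true ∷ T} ()

zipWith-+-cancelˡ : ∀ {n} (u v v′ : Vec ℕ n) → zipWith ℕ._+_ u v ≡ zipWith ℕ._+_ u v′ → v ≡ v′
zipWith-+-cancelˡ [] [] [] _ = refl
zipWith-+-cancelˡ (k ∷ u) (l ∷ v) (l′ ∷ v′) eq = cong₂ _∷_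
  (ℕP.+-cancelˡ-≡ k l l′ (VecP.∷-injectiveˡ eq))
  (zipWith-+-cancelˡ u v v′ (VecP.∷-injectiveʳ eq))

addWords-cancelˡ : ∀ {n} (S T T′ : Vec Bool n) → addWords S T ≡ addWords S T′ → T ≡ T′
addWords-cancelˡ S T T′ = toℕvec-injective ∘ zipWith-+-cancelˡ (toℕvec S) (toℕvec T) (toℕvec T′)

module _ {n} (w : Vec ℤ n) where

  udCodePair-fibre : ∀ {A B : List (Vec Bool n)} (x : ℤ) →
    AllPairs (λ S T → wsum w S ≢ wsum w T) A → All (λ T → wsum w T ≡ x) B → Unique B →
    UDCodePair A B
  udCodePair-fibre {A} {B} x distinctSums inFibre uniqueB = uniqueA , uniqueB , (begin
    sumSetCard A B                                                 ≡⟨ cong length (deduplicate-unique _ uniqueSums) ⟩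
    length (concatMap (λ S → map (addWords S) B) A)                ≡⟨ cong length (concatMap≡cartesianProductWith addWords A B) ⟩
    length (cartesianProductWith addWords A B)                     ≡⟨ length-cartesianProductWith addWords A B ⟩
    length A ℕ.* length B                                          ∎)
    where
    open ≡-Reasoning

    uniqueA : Unique A
    uniqueA = AllPairs.map (λ ≢sums S≡T → ≢sums (cong (wsum w) S≡T)) distinctSums

    addWords-injectiveOn : ∀ {S S′ T T′} → S ∈ A → S′ ∈ A → T ∈ B → T′ ∈ B →
                           addWords S T ≡ addWords S′ T′ → S ≡ S′ × T ≡ T′
    addWords-injectiveOn {S} {S′} {T} {T′} S∈A S′∈A T∈B T′∈B eq =
      S≡S′ , addWords-cancelˡ S′ T T′ (subst (λ R → addWords R T ≡ addWords S′ T′) S≡S′ eq)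
      where
      sameSum : wsum w S ℤ.+ x ≡ wsum w S′ ℤ.+ x
      sameSum = begin
        wsum w S ℤ.+ x                ≡⟨ cong (λ t → wsum w S ℤ.+ t) (sym (All.lookup inFibre T∈B)) ⟩
        wsum w S ℤ.+ wsum w T         ≡⟨ sym (·-addWords w S T) ⟩
        w · addWords S T              ≡⟨ cong (w ·_) eq ⟩
        w · addWords S′ T′            ≡⟨ ·-addWords w S′ T′ ⟩
        wsum w S′ ℤ.+ wsum w T′       ≡⟨ cong (λ t → wsum w S′ ℤ.+ t) (All.lookup inFibre T′∈B) ⟩
        wsum w S′ ℤ.+ x               ∎

      S≡S′ : S ≡ S′
      S≡S′ = distinctImages⇒injectiveOn (wsum w) distinctSums S∈A S′∈A
               (∙-cancelʳ x (wsum w S) (wsum w S′) sameSum)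

    uniqueSums : Unique (concatMap (λ S → map (addWords S) B) A)
    uniqueSums = subst Unique (sym (concatMap≡cartesianProductWith addWords A B))
      (cartesianProductWith⁺-injectiveOn addWords addWords-injectiveOn uniqueA uniqueB)

proposition4 : (n a b : ℕ) →
    Σ (Vec ℤ n) (λ w → (numSubsetSums w ≡ a) × IsBeta w b) →
    Σ (List (Vec Bool n)) (λ A → Σ (List (Vec Bool n)) (λ B →
    UDCodePair A B × (length A ≡ a) × (length B ≡ b)))
proposition4 n a b (w , #sums≡a , (x , #fibre≡b) , _) =
  A , B , udCodePair-fibre w x distinctSums fibre (UniqueP.filter⁺ fibre? (allSubsets-unique n)) ,
  #A≡a , #fibre≡b
  where
  open ≡-Reasoning

  fibre? : ∀ S → Dec (wsum w S ≡ x)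
  fibre? S = wsum w S ℤ.≟ x

  A B : List (Vec Bool n)
  A = deduplicate (λ S T → wsum w S ℤ.≟ wsum w T) (allSubsets n)
  B = filter fibre? (allSubsets n)

  distinctSums : AllPairs (λ S T → wsum w S ≢ wsum w T) A
  distinctSums = deduplicate-! (On.decSetoid ℤP.≡-decSetoid (wsum w)) (allSubsets n)

  fibre : All (λ T → wsum w T ≡ x) B
  fibre = AllP.all-filter fibre? (allSubsets n)

  #A≡a : length A ≡ a
  #A≡a = begin
    length A                   ≡⟨ sym (ListP.length-map (wsum w) A) ⟩
    length (map (wsum w) A)    ≡⟨ cong length (map-deduplicate-on ℤ._≟_ (wsum w) (allSubsets n)) ⟩
    numSubsetSums w            ≡⟨ #sums≡a ⟩
    a                          ∎
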